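{- Let $m,l\ge 2$ be integers. Then $\chi_{=}(K_1\circ^l P_m)=3$ if $m=4$, and $\chi_{=}(K_1\circ^l P_m)\le 4$ otherwise.
   Context: All graphs are finite, simple and connected. $K_1$ is the single-vertex graph and $P_m$ the path on $m$ vertices. A graph is equitably $k$-colorable if its vertex set can be partitioned into $k$ (possibly empty) independent sets $V_1,\dots,V_k$ with $||V_i|-|V_j||\le 1$ for all $i,j$; $\chi_{=}(G)$ is the least $k$ for which $G$ is equitably $k$-colorable. The corona $G\circ H$ is formed from one copy of $G$ and $|V(G)|$ copies of $H$, the $i$-th vertex of $G$ being joined to every vertex of the $i$-th copy of $H$; $G\circ^1 H=G\circ H$ and $G\circ^l H=(G\circ^{l-1}H)\circ H$ for $l\ge 2$. -}

module Defs where

open import Data.Nat using (ℕ; zero; suc; _+_; _*_; _≤_; _<_)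
open import Data.Nat.Properties using () renaming (_≟_ to _≟ℕ_)
open import Data.Fin using (Fin; toℕ; splitAt; remQuot; _≟_)
open import Data.Bool using (Bool; true; false; _∧_; _∨_)
open import Data.Sum using (_⊎_; inj₁; inj₂)
open import Data.Product using (_×_; _,_; proj₁; proj₂)
open import Data.List using (length; filter; allFin)
open import Relation.Nullary using (¬_; ⌊_⌋)
open import Relation.Binary.PropositionalEquality using (_≡_; _≢_)

record Graph : Set where
  field
    size  : ℕ
    adj   : Fin size → Fin size → Bool
    sym   : ∀ u v → adj u v ≡ adj v u
    irrefl : ∀ v → adj v v ≡ false
open Graph public

-- Adjacency of the corona G ∘ H on vertices Fin (n + n * k):
-- the first n vertices form the copy of G; a vertex of the second block
-- corresponds via remQuot to a pair (i , x): vertex x of the i-th copy of H.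
coronaAdj : ∀ n k → (Fin n → Fin n → Bool) → (Fin k → Fin k → Bool)
          → Fin (n + n * k) → Fin (n + n * k) → Bool
coronaAdj n k g h a b with splitAt n a | splitAt n b
... | inj₁ i | inj₁ j = g i j
... | inj₁ i | inj₂ p = ⌊ i ≟ proj₁ (remQuot {n} k p) ⌋
... | inj₂ p | inj₁ j = ⌊ proj₁ (remQuot {n} k p) ≟ j ⌋
... | inj₂ p | inj₂ q =
  ⌊ proj₁ (remQuot {n} k p) ≟ proj₁ (remQuot {n} k q) ⌋ ∧ h (proj₂ (remQuot {n} k p)) (proj₂ (remQuot {n} k q))

≟-sym : ∀ {n} (a b : Fin n) → ⌊ a ≟ b ⌋ ≡ ⌊ b ≟ a ⌋
≟-sym a b with a ≟ b | b ≟ a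
... | Relation.Nullary.yes _ | Relation.Nullary.yes _ = Relation.Binary.PropositionalEquality.refl
... | Relation.Nullary.yes e | Relation.Nullary.no ne = Data.Empty.⊥-elim (ne (Relation.Binary.PropositionalEquality.sym e))
  where import Data.Empty
... | Relation.Nullary.no ne | Relation.Nullary.yes e = Data.Empty.⊥-elim (ne (Relation.Binary.PropositionalEquality.sym e))
  where import Data.Empty
... | Relation.Nullary.no _ | Relation.Nullary.no _ = Relation.Binary.PropositionalEquality.refl

coronaAdj-sym : ∀ n k (g : Fin n → Fin n → Bool) (h : Fin k → Fin k → Bool)
  → (∀ u v → g u v ≡ g v u) → (∀ u v → h u v ≡ h v u)
  → ∀ a b → coronaAdj n k g h a b ≡ coronaAdj n k g h b a
coronaAdj-sym n k g h gs hs a b with splitAt n a | splitAt n b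
... | inj₁ i | inj₁ j = gs i j
... | inj₁ i | inj₂ p = ≟-sym i (proj₁ (remQuot {n} k p))
... | inj₂ p | inj₁ j = ≟-sym (proj₁ (remQuot {n} k p)) j
... | inj₂ p | inj₂ q = Relation.Binary.PropositionalEquality.cong₂ _∧_
        (≟-sym (proj₁ (remQuot {n} k p)) (proj₁ (remQuot {n} k q))) (hs _ _)

coronaAdj-irrefl : ∀ n k (g : Fin n → Fin n → Bool) (h : Fin k → Fin k → Bool)
  → (∀ v → g v v ≡ false) → (∀ v → h v v ≡ false)
  → ∀ a → coronaAdj n k g h a a ≡ false
coronaAdj-irrefl n k g h gi hi a with splitAt n a
... | inj₁ i = gi i
... | inj₂ p with proj₁ (remQuot {n} k p) ≟ proj₁ (remQuot {n} k p)
...   | Relation.Nullary.yes _ = hi _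
...   | Relation.Nullary.no _ = Relation.Binary.PropositionalEquality.refl

corona : Graph → Graph → Graph
corona G H = record
  { size   = size G + size G * size H
  ; adj    = coronaAdj (size G) (size H) (adj G) (adj H)
  ; sym    = coronaAdj-sym (size G) (size H) (adj G) (adj H) (sym G) (sym H)
  ; irrefl = coronaAdj-irrefl (size G) (size H) (adj G) (adj H) (irrefl G) (irrefl H)
  }

coronaIter : Graph → Graph → ℕ → Graph
coronaIter G H zero    = G
coronaIter G H (suc l) = corona (coronaIter G H l) H

K1 : Graph
K1 = record { size = 1 ; adj = λ _ _ → false
            ; sym = λ _ _ → Relation.Binary.PropositionalEquality.refl
            ; irrefl = λ _ → Relation.Binary.PropositionalEquality.refl }

pathAdj : ∀ m → Fin m → Fin m → Bool
pathAdj m i j = ⌊ suc (toℕ i) ≟ℕ toℕ j ⌋ ∨ ⌊ suc (toℕ j) ≟ℕ toℕ i ⌋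

pathAdj-sym : ∀ m u v → pathAdj m u v ≡ pathAdj m v u
pathAdj-sym m u v with suc (toℕ u) ≟ℕ toℕ v | suc (toℕ v) ≟ℕ toℕ u
... | Relation.Nullary.yes _ | Relation.Nullary.yes _ = Relation.Binary.PropositionalEquality.refl
... | Relation.Nullary.yes _ | Relation.Nullary.no _ = Relation.Binary.PropositionalEquality.refl
... | Relation.Nullary.no _ | Relation.Nullary.yes _ = Relation.Binary.PropositionalEquality.refl
... | Relation.Nullary.no _ | Relation.Nullary.no _ = Relation.Binary.PropositionalEquality.refl

pathAdj-irrefl : ∀ m v → pathAdj m v v ≡ false
pathAdj-irrefl m v with suc (toℕ v) ≟ℕ toℕ v
... | Relation.Nullary.yes e = Data.Empty.⊥-elim (Data.Nat.Properties.1+n≢n e)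
  where import Data.Empty
        import Data.Nat.Properties
... | Relation.Nullary.no _ = Relation.Binary.PropositionalEquality.refl

P : ℕ → Graph
P m = record { size = m ; adj = pathAdj m ; sym = pathAdj-sym m ; irrefl = pathAdj-irrefl m }

classSize : ∀ {n k} → (Fin n → Fin k) → Fin k → ℕ
classSize {n} c i = length (filter (λ v → c v ≟ i) (allFin n))

record EquitableColoring (G : Graph) (k : ℕ) : Set where
  field
    colour   : Fin (size G) → Fin k
    proper   : ∀ u v → adj G u v ≡ true → colour u ≢ colour v
    balanced : ∀ i j → classSize colour i ≤ classSize colour j + 1

EquitablyColorable : Graph → ℕ → Set
EquitablyColorable G k = EquitableColoring G k

IsEqChromaticNumber : Graph → ℕ → Set
IsEqChromaticNumber G k = EquitablyColorable G k × (∀ j → j < k → ¬ EquitablyColorable G j)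

module Submission where

-- A vertex of G together with two adjacent vertices of its copy of P_m (m ≥ 2) is a
-- triangle, so every proper colouring of K₁ ∘^l P_m uses at least three colours.
--
-- For m = 4, an equitable 3-colouring of G extends to G ∘ P₄: the copy of P₄ at a vertex
-- of colour a alternates the two other colours. Each copy then meets every colour b ≠ a
-- twice, so class b of the new colouring has 2|V(G)| − |old class b| vertices and the
-- classes stay balanced.
--
-- For l ≥ 2 it suffices to equitably 4-colour (G ∘ P_m) ∘ P_m, given a proper colouring
-- of G = K₁ ∘^(l−2) P_m. Each vertex w of G spans a block K₁ ∘ P_m ∘ P_m of (m + 1)²
-- vertices, coloured by a fixed template relabelled so that its root gets the colour of
-- w. For odd m the template uses every colour (m + 1)²/4 times; for even m every colour
-- ⌊(m + 1)²/4⌋ times plus one surplus vertex, whose colour is chosen cyclically in w.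
-- Equitable colourability being decidable, χ₌ is then the least k admitting one, so it
-- exists and is at most 4.

open import Defs hiding (sym)

open import Data.Bool as Bool using (Bool; true; false; if_then_else_; _∧_)
open import Data.Fin
  using (Fin; zero; suc; toℕ; inject₁; splitAt; remQuot; combine; _↑ˡ_; _↑ʳ_; _≟_; finToFun; funToFin)
open import Data.Fin.Patterns using (0F; 1F; 2F; 3F)
open import Data.Fin.Permutation
  using (Permutation′; _⟨$⟩ʳ_; _⟨$⟩ˡ_; inverseˡ; inverseʳ; transpose; _∘ₚ_)
open import Data.Fin.Properties
  using (splitAt-↑ˡ; splitAt-↑ʳ; remQuot-combine; finToFun-funToFin; any?; all?; pigeonhole)
import Data.Fin.Properties as Fin
open import Data.List using (length; filter; tabulate)
open import Data.Nat as ℕ using (ℕ; zero; suc; _+_; _*_; _^_; _≤_; _<_; z≤n; s≤s; ⌊_/2⌋; ⌈_/2⌉)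
open import Data.Nat.Induction using (<-rec)
open import Data.Nat.Properties hiding (_≟_)
open import Algebra.Properties.Semiring.Sum +-*-semiring
  using (sum-syntax; sum-cong-≗; ∑-distrib-+; *-distribˡ-sum; sum-replicate-zero)
open import Data.Nat.Tactic.RingSolver using (solve-∀)
open import Data.Product using (_×_; _,_; proj₁; proj₂; ∃; uncurry)
open import Data.Sum using (inj₁; inj₂; [_,_]′)
open import Function using (_∘_)
open import Level using (0ℓ)
open import Relation.Binary.PropositionalEquality
open import Relation.Nullary using (¬_; Dec; yes; no; does; ⌊_⌋)
open import Relation.Nullary.Decidable
  using (dec-true; dec-false; isYes≗does; map′; _×-dec_; _→-dec_; ¬?)
open import Relation.Nullary.Negation using (contradiction)
open import Relation.Unary using (Pred; Decidable)

δ : ∀ {k} → Fin k → Fin k → ℕ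
δ a b = if does (a ≟ b) then 1 else 0

δ≤1 : ∀ {k} (a b : Fin k) → δ a b ≤ 1
δ≤1 a b with does (a ≟ b)
... | true  = ≤-refl
... | false = z≤n

count : ∀ {n k} → (Fin n → Fin k) → Fin k → ℕ
count {n} c b = ∑[ v < n ] δ (c v) b

∑-δ : ∀ {k} (b : Fin k) → ∑[ z < k ] δ z b ≡ 1
∑-δ {suc k} zero    = cong suc (sum-replicate-zero k)
∑-δ {suc k} (suc b) = ∑-δ b

∑-const : ∀ n c → ∑[ i < n ] c ≡ n * c
∑-const zero    c = refl
∑-const (suc n) c = cong (c +_) (∑-const n c)

∑-↑ : ∀ m {n} (f : Fin (m + n) → ℕ) →
      ∑[ i < m + n ] f i ≡ ∑[ i < m ] f (i ↑ˡ n) + ∑[ j < n ] f (m ↑ʳ j)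
∑-↑ zero    f = refl
∑-↑ (suc m) f = trans (cong (f zero +_) (∑-↑ m (f ∘ suc))) (sym (+-assoc (f zero) _ _))

∑-combine : ∀ m {n} (f : Fin (m * n) → ℕ) →
            ∑[ i < m * n ] f i ≡ ∑[ i < m ] ∑[ j < n ] f (combine i j)
∑-combine zero    f = refl
∑-combine (suc m) {n} f =
  trans (∑-↑ n f) (cong (∑[ j < n ] f (j ↑ˡ m * n) +_) (∑-combine m (f ∘ (n ↑ʳ_))))

∑-prefix : ∀ n k (g : ℕ → ℕ) → ∑[ i < n ] g (toℕ i) ≤ ∑[ i < n + k ] g (toℕ i)
∑-prefix zero    k g = z≤n
∑-prefix (suc n) k g = +-monoʳ-≤ (g 0) (∑-prefix n k (g ∘ suc))

length-filter-tabulate : ∀ {A : Set} {P : Pred A 0ℓ} (P? : Decidable P) {n} (f : Fin n → A) →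
  length (filter P? (tabulate f)) ≡ ∑[ i < n ] (if does (P? (f i)) then 1 else 0)
length-filter-tabulate P? {zero}  f = refl
length-filter-tabulate P? {suc n} f with does (P? (f zero))
... | true  = cong suc (length-filter-tabulate P? (f ∘ suc))
... | false = length-filter-tabulate P? (f ∘ suc)

classSize≡count : ∀ {n k} (c : Fin n → Fin k) b → classSize c b ≡ count c b
classSize≡count c b = length-filter-tabulate (λ v → c v ≟ b) (λ v → v)

δ-permute : ∀ {k} (π : Permutation′ k) z b → δ (π ⟨$⟩ʳ z) b ≡ δ z (π ⟨$⟩ˡ b)
δ-permute π z b with π ⟨$⟩ʳ z ≟ b | z ≟ π ⟨$⟩ˡ b
... | yes _    | yes _   = refl
... | no _     | no _    = refl
... | yes πz≡b | no z≢b′ = contradiction (trans (sym (inverseˡ π)) (cong (π ⟨$⟩ˡ_) πz≡b)) z≢b′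
... | no πz≢b  | yes z≡b′ = contradiction (trans (cong (π ⟨$⟩ʳ_) z≡b′) (inverseʳ π)) πz≢b

count-permute : ∀ {n k} (π : Permutation′ k) (c : Fin n → Fin k) b →
                count (λ v → π ⟨$⟩ʳ c v) b ≡ count c (π ⟨$⟩ˡ b)
count-permute π c b = sum-cong-≗ (λ v → δ-permute π (c v) b)

permute-injective : ∀ {k} (π : Permutation′ k) {x y} → π ⟨$⟩ʳ x ≡ π ⟨$⟩ʳ y → x ≡ y
permute-injective π {x} {y} eq =
  trans (sym (inverseˡ π)) (trans (cong (π ⟨$⟩ˡ_) eq) (inverseˡ π))

transpose-sends : ∀ {n} (i j : Fin n) → transpose i j ⟨$⟩ʳ i ≡ j
transpose-sends i j rewrite dec-true (i ≟ i) refl = refl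

transpose-fixes : ∀ {n} {i j k : Fin n} → k ≢ i → k ≢ j → transpose i j ⟨$⟩ʳ k ≡ k
transpose-fixes {i = i} {j} {k} k≢i k≢j
  rewrite dec-false (k ≟ i) k≢i | dec-false (k ≟ j) k≢j = refl

permutation-sending : ∀ {n} {s₀ s₁ a e : Fin n} → s₀ ≢ s₁ → a ≢ e →
                      ∃ λ (π : Permutation′ n) → π ⟨$⟩ʳ s₀ ≡ a × π ⟨$⟩ʳ s₁ ≡ e
permutation-sending {s₀ = s₀} {s₁} {a} {e} s₀≢s₁ a≢e =
  τ ∘ₚ σ , trans (cong (σ ⟨$⟩ʳ_) τs₀≡a) σa≡a , transpose-sends (τ ⟨$⟩ʳ s₁) e
  where
  τ σ : Permutation′ _
  τ = transpose s₀ a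
  σ = transpose (τ ⟨$⟩ʳ s₁) e
  τs₀≡a : τ ⟨$⟩ʳ s₀ ≡ a
  τs₀≡a = transpose-sends s₀ a
  σa≡a : σ ⟨$⟩ʳ a ≡ a
  σa≡a = transpose-fixes (λ a≡τs₁ → s₀≢s₁ (permute-injective τ (trans τs₀≡a a≡τs₁))) a≢e

coronaCase : ∀ {A : Set} {n h} → (Fin n → A) → (Fin n → Fin h → A) → Fin (n + n * h) → A
coronaCase {n = n} {h} f g v = [ f , uncurry g ∘ remQuot {n} h ]′ (splitAt n v)

module _ {A : Set} {n h} (f : Fin n → A) (g : Fin n → Fin h → A) where

  coronaCase-↑ˡ : ∀ i → coronaCase f g (i ↑ˡ n * h) ≡ f i
  coronaCase-↑ˡ i rewrite splitAt-↑ˡ n i (n * h) = refl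

  coronaCase-↑ʳ : ∀ i j → coronaCase f g (n ↑ʳ combine i j) ≡ g i j
  coronaCase-↑ʳ i j rewrite splitAt-↑ʳ n (n * h) (combine i j) =
    cong (uncurry g) (remQuot-combine i j)

  ∑-coronaCase : (φ : A → ℕ) →
    ∑[ v < n + n * h ] φ (coronaCase f g v) ≡ ∑[ i < n ] φ (f i) + ∑[ i < n ] ∑[ j < h ] φ (g i j)
  ∑-coronaCase φ = begin
    ∑[ v < n + n * h ] φ (coronaCase f g v)
      ≡⟨ ∑-↑ n _ ⟩
    ∑[ i < n ] φ (coronaCase f g (i ↑ˡ n * h)) + ∑[ p < n * h ] φ (coronaCase f g (n ↑ʳ p))
      ≡⟨ cong₂ _+_ (sum-cong-≗ (cong φ ∘ coronaCase-↑ˡ)) (∑-combine n _) ⟩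
    ∑[ i < n ] φ (f i) + ∑[ i < n ] ∑[ j < h ] φ (coronaCase f g (n ↑ʳ combine i j))
      ≡⟨ cong (∑[ i < n ] φ (f i) +_) (sum-cong-≗ λ i → sum-cong-≗ (cong φ ∘ coronaCase-↑ʳ i)) ⟩
    ∑[ i < n ] φ (f i) + ∑[ i < n ] ∑[ j < h ] φ (g i j) ∎
    where open ≡-Reasoning

  coronaCase-all : (Q : A → Set) → (∀ i → Q (f i)) → (∀ i j → Q (g i j)) →
                   ∀ v → Q (coronaCase f g v)
  coronaCase-all Q Qf Qg v with splitAt n v
  ... | inj₁ i = Qf i
  ... | inj₂ p = Qg _ _

coronaCase-rel : ∀ {A B : Set} {n h} (R : A → B → Set) {f : Fin n → A} {f′ : Fin n → B}
  {g : Fin n → Fin h → A} {g′ : Fin n → Fin h → B} →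
  (∀ i → R (f i) (f′ i)) → (∀ i j → R (g i j) (g′ i j)) →
  ∀ v → R (coronaCase f g v) (coronaCase f′ g′ v)
coronaCase-rel {n = n} R Rf Rg v with splitAt n v
... | inj₁ i = Rf i
... | inj₂ p = Rg _ _

count-coronaCase : ∀ {n h k} (c : Fin n → Fin k) (κ : Fin n → Fin h → Fin k) b →
                   count (coronaCase c κ) b ≡ count c b + ∑[ i < n ] count (κ i) b
count-coronaCase c κ b = ∑-coronaCase c κ (λ a → δ a b)

ProperColouring : ∀ {k} (G : Graph) → (Fin (size G) → Fin k) → Set
ProperColouring G c = ∀ u v → adj G u v ≡ true → c u ≢ c v

coronaCase-proper : ∀ {k} {G H : Graph} {c : Fin (size G) → Fin k}
  {κ : Fin (size G) → Fin (size H) → Fin k} →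
  ProperColouring G c → (∀ i → ProperColouring H (κ i)) → (∀ i x → κ i x ≢ c i) →
  ProperColouring (corona G H) (coronaCase c κ)
coronaCase-proper {G = G} {H} {c} {κ} c-proper κ-proper κ≢c u v u~v
  with splitAt (size G) u | splitAt (size G) v
... | inj₁ i | inj₁ j = c-proper i j u~v
... | inj₁ i | inj₂ p with i ≟ proj₁ (remQuot {size G} (size H) p)
...   | yes refl = κ≢c _ _ ∘ sym
coronaCase-proper {G = G} {H} c-proper κ-proper κ≢c u v u~v
    | inj₂ p | inj₁ j with proj₁ (remQuot {size G} (size H) p) ≟ j
...   | yes refl = κ≢c _ _
coronaCase-proper {G = G} {H} {κ = κ} c-proper κ-proper κ≢c u v u~v
    | inj₂ p | inj₂ q with proj₁ (remQuot {size G} (size H) p) ≟ proj₁ (remQuot {size G} (size H) q)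
...   | yes i≡j = λ κ≡ → κ-proper _ _ _ u~v (trans κ≡ (cong (λ i → κ i _) (sym i≡j)))

Avoids : ∀ {A : Set} {k} → (A → Fin k) → Fin k → Set
Avoids f a = ∀ x → f x ≢ a

ProperSequence : ∀ {k} → (ℕ → Fin k) → Set
ProperSequence f = ∀ x → f x ≢ f (suc x)

path-proper : ∀ {m k} {f : ℕ → Fin k} → ProperSequence f → ProperColouring (P m) (f ∘ toℕ)
path-proper {f = f} f-proper i j i~j with suc (toℕ i) ℕ.≟ toℕ j | suc (toℕ j) ℕ.≟ toℕ i
... | yes i+1≡j | _         = subst (λ y → f (toℕ i) ≢ f y) i+1≡j (f-proper (toℕ i))
... | no _      | yes j+1≡i = subst (λ x → f x ≢ f (toℕ j)) j+1≡i (f-proper (toℕ j) ∘ sym)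

module _ {A : Set} where

  alternate : A → A → ℕ → A
  alternate u v zero    = u
  alternate u v (suc x) = alternate v u x

  infixr 5 _◃_

  _◃_ : A → (ℕ → A) → ℕ → A
  (z ◃ f) zero    = z
  (z ◃ f) (suc x) = f x

  alternate-all : ∀ (Q : A → Set) {u v} → Q u → Q v → ∀ x → Q (alternate u v x)
  alternate-all Q Qu Qv zero    = Qu
  alternate-all Q Qu Qv (suc x) = alternate-all Q Qv Qu x

  ◃-all : ∀ (Q : A → Set) {z f} → Q z → (∀ x → Q (f x)) → ∀ x → Q ((z ◃ f) x)
  ◃-all Q Qz Qf zero    = Qz
  ◃-all Q Qz Qf (suc x) = Qf x

  ∑-alternate : ∀ (g : A → ℕ) n u v →
    ∑[ i < n ] g (alternate u v (toℕ i)) ≡ ⌈ n /2⌉ * g u + ⌊ n /2⌋ * g v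
  ∑-alternate g zero    u v = refl
  ∑-alternate g (suc n) u v = begin
    g u + ∑[ i < n ] g (alternate v u (toℕ i))  ≡⟨ cong (g u +_) (∑-alternate g n v u) ⟩
    g u + (⌈ n /2⌉ * g v + ⌊ n /2⌋ * g u)       ≡⟨ shuffle (g u) (⌈ n /2⌉ * g v) (⌊ n /2⌋ * g u) ⟩
    (g u + ⌊ n /2⌋ * g u) + ⌈ n /2⌉ * g v       ∎
    where
    open ≡-Reasoning
    shuffle : ∀ a b c → a + (b + c) ≡ (a + c) + b
    shuffle = solve-∀

  ∑-alternate-double : ∀ (g : A → ℕ) s u v →
    ∑[ i < s + s ] g (alternate u v (toℕ i)) ≡ s * g u + s * g v
  ∑-alternate-double g s u v = begin
    ∑[ i < s + s ] g (alternate u v (toℕ i))   ≡⟨ ∑-alternate g (s + s) u v ⟩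
    ⌈ s + s /2⌉ * g u + ⌊ s + s /2⌋ * g v
      ≡⟨ sym (cong₂ (λ p q → p * g u + q * g v) (n≡⌈n+n/2⌉ s) (n≡⌊n+n/2⌋ s)) ⟩
    s * g u + s * g v                         ∎
    where open ≡-Reasoning

  ∑-alternate-odd : ∀ (g : A → ℕ) s u v →
    ∑[ i < suc (s + s) ] g (alternate u v (toℕ i)) ≡ suc s * g u + s * g v
  ∑-alternate-odd g s u v =
    trans (cong (g u +_) (∑-alternate-double g s v u)) (regroup (g u) (g v) s)
    where
    regroup : ∀ a c s → a + (s * c + s * a) ≡ suc s * a + s * c
    regroup = solve-∀

  ∑-alternate-even : ∀ (g : A → ℕ) s u v →
    ∑[ i < suc (suc (s + s)) ] g (alternate u v (toℕ i)) ≡ suc s * g u + suc s * g v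
  ∑-alternate-even g s u v =
    trans (cong (λ x → g u + (g v + x)) (∑-alternate-double g s u v)) (regroup (g u) (g v) s)
    where
    regroup : ∀ a c s → a + (c + (s * a + s * c)) ≡ suc s * a + suc s * c
    regroup = solve-∀

alternate-rel : ∀ {A B : Set} (R : A → B → Set) {u v : A} {u′ v′ : B} →
                R u u′ → R v v′ → ∀ x → R (alternate u v x) (alternate u′ v′ x)
alternate-rel R Ruu′ Rvv′ zero    = Ruu′
alternate-rel R Ruu′ Rvv′ (suc x) = alternate-rel R Rvv′ Ruu′ x

alternate-proper : ∀ {k} {u v : Fin k} → u ≢ v → ProperSequence (alternate u v)
alternate-proper u≢v zero    = u≢v
alternate-proper u≢v (suc x) = alternate-proper (u≢v ∘ sym) x

◃-proper : ∀ {k} {z : Fin k} {f} → z ≢ f 0 → ProperSequence f → ProperSequence (z ◃ f)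
◃-proper z≢f0 f-proper zero    = z≢f0
◃-proper z≢f0 f-proper (suc x) = f-proper x

-- Existence of the equitable chromatic number

ProperColouring-resp : ∀ {k} (G : Graph) {c c′ : Fin (size G) → Fin k} →
                       c ≗ c′ → ProperColouring G c → ProperColouring G c′
ProperColouring-resp G c≗c′ c-proper u v u~v cu≡cv =
  c-proper u v u~v (trans (c≗c′ u) (trans cu≡cv (sym (c≗c′ v))))

Balanced : ∀ {n k} → (Fin n → Fin k) → Set
Balanced c = ∀ i j → classSize c i ≤ classSize c j + 1

Balanced-resp : ∀ {n k} {c c′ : Fin n → Fin k} → c ≗ c′ → Balanced c → Balanced c′
Balanced-resp {c = c} {c′} c≗c′ c-balanced i j =
  subst₂ (λ x y → x ≤ y + 1) (same i) (same j) (c-balanced i j)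
  where
  same : ∀ b → classSize c b ≡ classSize c′ b
  same b = trans (classSize≡count c b)
             (trans (sum-cong-≗ λ v → cong (λ a → δ a b) (c≗c′ v)) (sym (classSize≡count c′ b)))

equitableColoring? : ∀ G k → Dec (EquitableColoring G k)
equitableColoring? G k =
  map′ decode encode (any? λ x → properColouring? (colouring x) ×-dec balanced? (colouring x))
  where
  colouring : Fin (k ^ size G) → Fin (size G) → Fin k
  colouring = finToFun
  properColouring? : ∀ c → Dec (ProperColouring G c)
  properColouring? c = all? λ u → all? λ v → (adj G u v Bool.≟ true) →-dec ¬? (c u ≟ c v)
  balanced? : (c : Fin (size G) → Fin k) → Dec (Balanced c)
  balanced? c = all? λ i → all? λ j → classSize c i ℕ.≤? classSize c j + 1
  Code : Set
  Code = ∃ λ x → ProperColouring G (colouring x) × Balanced (colouring x)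
  decode : Code → EquitableColoring G k
  decode (x , c-proper , c-balanced) =
    record { colour = colouring x ; proper = c-proper ; balanced = c-balanced }
  encode : EquitableColoring G k → Code
  encode E = funToFin colour
           , ProperColouring-resp G (sym ∘ finToFun-funToFin colour) proper
           , Balanced-resp (sym ∘ finToFun-funToFin colour) balanced
    where open EquitableColoring E

least : ∀ {P : ℕ → Set} → (∀ n → Dec (P n)) →
        ∀ n → P n → ∃ λ k → (P k × (∀ j → j < k → ¬ P j)) × k ≤ n
least {P} P? = <-rec (λ n → P n → LeastBelow n) search
  where
  LeastBelow : ℕ → Set
  LeastBelow n = ∃ λ k → (P k × (∀ j → j < k → ¬ P j)) × k ≤ n
  search : ∀ n → (∀ {j} → j < n → P j → LeastBelow j) → P n → LeastBelow n
  search n below Pn with anyUpTo? P? n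
  ... | yes (j , j<n , Pj) =
    let k , minimal , k≤j = below j<n Pj in k , minimal , ≤-trans k≤j (<⇒≤ j<n)
  ... | no none            = n , (Pn , λ j j<n Pj → none (j , j<n , Pj)) , ≤-refl

eqChromaticNumber-exists : ∀ G {n} → EquitablyColorable G n →
                           ∃ λ k → IsEqChromaticNumber G k × k ≤ n
eqChromaticNumber-exists G {n} = least (equitableColoring? G) n

-- Three colours are necessary

three-distinct⇒3≤k : ∀ {k} (c : Fin 3 → Fin k) → (∀ {i j} → i ≢ j → c i ≢ c j) → 3 ≤ k
three-distinct⇒3≤k c distinct = ≮⇒≥ λ k<3 →
  let i , j , i<j , ci≡cj = pigeonhole k<3 c in distinct (Fin.<⇒≢ i<j) ci≡cj

⌊≟⌋-refl : ∀ {n} (a : Fin n) → ⌊ a ≟ a ⌋ ≡ true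
⌊≟⌋-refl a = trans (isYes≗does (a ≟ a)) (dec-true (a ≟ a) refl)

module _ (G H : Graph) (g : Fin (size G)) where

  private
    n = size G
    h = size H

  corona-apex~copy : ∀ x → adj (corona G H) (g ↑ˡ n * h) (n ↑ʳ combine g x) ≡ true
  corona-apex~copy x rewrite splitAt-↑ˡ n g (n * h) | splitAt-↑ʳ n (n * h) (combine g x) =
    trans (cong (λ r → ⌊ g ≟ proj₁ r ⌋) (remQuot-combine g x)) (⌊≟⌋-refl g)

  corona-copy~copy : ∀ x y → adj (corona G H) (n ↑ʳ combine g x) (n ↑ʳ combine g y) ≡ adj H x y
  corona-copy~copy x y
    rewrite splitAt-↑ʳ n (n * h) (combine g x) | splitAt-↑ʳ n (n * h) (combine g y) =
    trans (cong₂ (λ r s → ⌊ proj₁ r ≟ proj₁ s ⌋ ∧ adj H (proj₂ r) (proj₂ s))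
                 (remQuot-combine g x) (remQuot-combine g y))
          (cong (_∧ adj H x y) (⌊≟⌋-refl g))

corona-path-needs-3-colours : ∀ {k} (G : Graph) m → Fin (size G) →
  {c : Fin (size (corona G (P (suc (suc m))))) → Fin k} →
  ProperColouring (corona G (P (suc (suc m)))) c → 3 ≤ k
corona-path-needs-3-colours G m g {c} c-proper =
  three-distinct⇒3≤k (c ∘ triangle) λ i≢j → c-proper _ _ (triangle-adjacent _ _ i≢j)
  where
  H = P (suc (suc m))
  triangle : Fin 3 → Fin (size (corona G H))
  triangle 0F = g ↑ˡ size G * size H
  triangle 1F = size G ↑ʳ combine g 0F
  triangle 2F = size G ↑ʳ combine g 1F
  triangle-adjacent : ∀ i j → i ≢ j → adj (corona G H) (triangle i) (triangle j) ≡ true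
  triangle-adjacent 0F 0F i≢j = contradiction refl i≢j
  triangle-adjacent 1F 1F i≢j = contradiction refl i≢j
  triangle-adjacent 2F 2F i≢j = contradiction refl i≢j
  triangle-adjacent 0F 1F _ = corona-apex~copy G H g 0F
  triangle-adjacent 0F 2F _ = corona-apex~copy G H g 1F
  triangle-adjacent 1F 2F _ = corona-copy~copy G H g 0F 1F
  triangle-adjacent 1F 0F _ = trans (Graph.sym (corona G H) _ _) (corona-apex~copy G H g 0F)
  triangle-adjacent 2F 0F _ = trans (Graph.sym (corona G H) _ _) (corona-apex~copy G H g 1F)
  triangle-adjacent 2F 1F _ = trans (Graph.sym (corona G H) _ _) (corona-copy~copy G H g 0F 1F)

coronaIter-vertex : ∀ H l → Fin (size (coronaIter K1 H l))
coronaIter-vertex H zero    = 0F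
coronaIter-vertex H (suc l) = coronaIter-vertex H l ↑ˡ _

coronaIter-needs-3-colours : ∀ {m l k} → 2 ≤ m →
                             EquitableColoring (coronaIter K1 (P m) (suc l)) k → 3 ≤ k
coronaIter-needs-3-colours {suc (suc m)} {l} (s≤s (s≤s _)) E =
  corona-path-needs-3-colours (coronaIter K1 H l) m (coronaIter-vertex H l) (EquitableColoring.proper E)
  where H = P (suc (suc m))

-- Three colours suffice for corona powers of P₄

next : Fin 3 → Fin 3
next 0F = 1F
next 1F = 2F
next 2F = 0F

next≢ : ∀ a → next a ≢ a
next≢ 0F ()
next≢ 1F ()
next≢ 2F ()

next²≢ : ∀ a → next (next a) ≢ a
next²≢ 0F ()
next²≢ 1F ()
next²≢ 2F ()

rotationPath : Fin 3 → ℕ → Fin 3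
rotationPath a = alternate (next a) (next (next a))

rotationColouring : ∀ {n m} → (Fin n → Fin 3) → Fin (n + n * m) → Fin 3
rotationColouring c = coronaCase c (λ i → rotationPath (c i) ∘ toℕ)

rotationColouring-proper : ∀ {G} {m} {c : Fin (size G) → Fin 3} →
  ProperColouring G c → ProperColouring (corona G (P m)) (rotationColouring {m = m} c)
rotationColouring-proper {G} {m} {c} c-proper = coronaCase-proper {G = G} {P m} c-proper
  (λ i → path-proper (alternate-proper (next≢ (next (c i)) ∘ sym)))
  (λ i x → alternate-all (_≢ c i) (next≢ (c i)) (next²≢ (c i)) (toℕ x))

rotationPath-count : ∀ a b → count (rotationPath a ∘ toℕ {4}) b + 2 * δ a b ≡ 2
rotationPath-count 0F 0F = refl
rotationPath-count 0F 1F = refl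
rotationPath-count 0F 2F = refl
rotationPath-count 1F 0F = refl
rotationPath-count 1F 1F = refl
rotationPath-count 1F 2F = refl
rotationPath-count 2F 0F = refl
rotationPath-count 2F 1F = refl
rotationPath-count 2F 2F = refl

corona-P4-equitable3 : ∀ {G} → EquitableColoring G 3 → EquitableColoring (corona G (P 4)) 3
corona-P4-equitable3 {G} E = record
  { colour   = c′
  ; proper   = rotationColouring-proper {G} {4} proper
  ; balanced = λ i j → +-cancelʳ-≤ (classSize colour i) _ _ (begin
      classSize c′ i + classSize colour i  ≡⟨ trans (complement i) (sym (complement j)) ⟩
      classSize c′ j + classSize colour j  ≤⟨ +-monoʳ-≤ (classSize c′ j) (balanced j i) ⟩
      classSize c′ j + (classSize colour i + 1)  ≡⟨ shuffle (classSize c′ j) (classSize colour i) ⟩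
      classSize c′ j + 1 + classSize colour i ∎)
  }
  where
  open EquitableColoring E
  n = size G
  c′ = rotationColouring {m = 4} colour
  copy : Fin n → Fin 4 → Fin 3
  copy i = rotationPath (colour i) ∘ toℕ
  copies : Fin 3 → ℕ
  copies b = ∑[ i < n ] count (copy i) b
  shuffle : ∀ a b → a + (b + 1) ≡ a + 1 + b
  shuffle = solve-∀
  complement : ∀ b → classSize c′ b + classSize colour b ≡ 2 * n
  complement b = begin
    classSize c′ b + classSize colour b
      ≡⟨ cong₂ _+_ (trans (classSize≡count c′ b) (count-coronaCase colour copy b))
                   (classSize≡count colour b) ⟩
    count colour b + copies b + count colour b
      ≡⟨ regroup (count colour b) (copies b) ⟩
    copies b + 2 * count colour b
      ≡⟨ cong (copies b +_) (*-distribˡ-sum 2 (λ i → δ (colour i) b)) ⟩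
    copies b + ∑[ i < n ] (2 * δ (colour i) b)
      ≡⟨ sym (∑-distrib-+ (λ i → count (copy i) b) (λ i → 2 * δ (colour i) b)) ⟩
    ∑[ i < n ] (count (copy i) b + 2 * δ (colour i) b)
      ≡⟨ sum-cong-≗ (λ i → rotationPath-count (colour i) b) ⟩
    ∑[ i < n ] 2
      ≡⟨ trans (∑-const n 2) (*-comm n 2) ⟩
    2 * n ∎
    where
    open ≡-Reasoning
    regroup : ∀ o t → o + t + o ≡ t + 2 * o
    regroup = solve-∀
  open ≤-Reasoning

K1-equitable : ∀ k → EquitableColoring K1 (suc k)
K1-equitable k = record
  { colour   = λ _ → 0F
  ; proper   = λ _ _ ()
  ; balanced = λ i j → ≤-trans (single i) (m≤n+m 1 _)
  }
  where
  single : ∀ i → classSize {1} (λ _ → 0F) i ≤ 1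
  single i =
    subst (_≤ 1) (sym (trans (classSize≡count {1} (λ _ → 0F) i) (+-identityʳ (δ 0F i)))) (δ≤1 0F i)

coronaIter-P4-equitable3 : ∀ l → EquitableColoring (coronaIter K1 (P 4) l) 3
coronaIter-P4-equitable3 zero    = K1-equitable 2
coronaIter-P4-equitable3 (suc l) = corona-P4-equitable3 (coronaIter-P4-equitable3 l)

coronaIter-proper3 : ∀ m l →
  ∃ λ (c : Fin (size (coronaIter K1 (P m) l)) → Fin 3) → ProperColouring (coronaIter K1 (P m) l) c
coronaIter-proper3 m zero    = (λ _ → 0F) , λ _ _ ()
coronaIter-proper3 m (suc l) =
  let c , c-proper = coronaIter-proper3 m l
  in  rotationColouring c , rotationColouring-proper {coronaIter K1 (P m) l} {m} c-proper

-- Four colours suffice for two corona layers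

-- A proper colouring of the block K₁ ∘ H ∘ H: the root, its copy of H in the first layer
-- (inner), its copy of H in the second layer (outer), and the copies of H attached to the
-- inner vertices (leaf).
record TwoLevelColouring (H : Graph) (k : ℕ) : Set where
  field
    root         : Fin k
    inner outer  : Fin (size H) → Fin k
    leaf         : Fin (size H) → Fin (size H) → Fin k
    inner-proper : ProperColouring H inner
    outer-proper : ProperColouring H outer
    leaf-proper  : ∀ y → ProperColouring H (leaf y)
    inner≢root   : ∀ y → inner y ≢ root
    outer≢root   : ∀ x → outer x ≢ root
    leaf≢inner   : ∀ y x → leaf y x ≢ inner y

  colourCount : Fin k → ℕ
  colourCount b = δ root b + count inner b + count outer b + ∑[ y < size H ] count (leaf y) b

open TwoLevelColouring

relabel : ∀ {H k} → Permutation′ k → TwoLevelColouring H k → TwoLevelColouring H k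
relabel π T = record
  { root         = π ⟨$⟩ʳ root T
  ; inner        = λ y → π ⟨$⟩ʳ inner T y
  ; outer        = λ x → π ⟨$⟩ʳ outer T x
  ; leaf         = λ y x → π ⟨$⟩ʳ leaf T y x
  ; inner-proper = λ u v u~v → inner-proper T u v u~v ∘ permute-injective π
  ; outer-proper = λ u v u~v → outer-proper T u v u~v ∘ permute-injective π
  ; leaf-proper  = λ y u v u~v → leaf-proper T y u v u~v ∘ permute-injective π
  ; inner≢root   = λ y → inner≢root T y ∘ permute-injective π
  ; outer≢root   = λ x → outer≢root T x ∘ permute-injective π
  ; leaf≢inner   = λ y x → leaf≢inner T y x ∘ permute-injective π
  }

colourCount-relabel : ∀ {H k} (π : Permutation′ k) (T : TwoLevelColouring H k) b →
                      colourCount (relabel π T) b ≡ colourCount T (π ⟨$⟩ˡ b)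
colourCount-relabel π T b =
  cong₂ _+_ (cong₂ _+_ (cong₂ _+_ (δ-permute π (root T) b) (count-permute π (inner T) b))
                       (count-permute π (outer T) b))
            (sum-cong-≗ λ y → count-permute π (leaf T y) b)

module _ {G H : Graph} {k} (T : Fin (size G) → TwoLevelColouring H k) where

  private
    n = size G
    h = size H

  corona²Colouring : Fin (size (corona (corona G H) H)) → Fin k
  corona²Colouring =
    coronaCase (coronaCase (root ∘ T) (inner ∘ T)) (coronaCase (outer ∘ T) (leaf ∘ T))

  corona²Colouring-proper : ProperColouring G (root ∘ T) →
                            ProperColouring (corona (corona G H) H) corona²Colouring
  corona²Colouring-proper root-proper = coronaCase-proper {G = corona G H} {H}
    (coronaCase-proper {G = G} {H} root-proper (inner-proper ∘ T) (inner≢root ∘ T))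
    (coronaCase-all (outer ∘ T) (leaf ∘ T) (ProperColouring H) (outer-proper ∘ T) (leaf-proper ∘ T))
    (coronaCase-rel Avoids {outer ∘ T} {root ∘ T} {leaf ∘ T} {inner ∘ T}
                    (outer≢root ∘ T) (leaf≢inner ∘ T))

  count-corona²Colouring : ∀ b → count corona²Colouring b ≡ ∑[ w < n ] colourCount (T w) b
  count-corona²Colouring b = begin
    count corona²Colouring b
      ≡⟨ count-coronaCase first second b ⟩
    count first b + ∑[ v < n + n * h ] count (second v) b
      ≡⟨ cong₂ _+_ (count-coronaCase (root ∘ T) (inner ∘ T) b)
                   (∑-coronaCase (outer ∘ T) (leaf ∘ T) (λ c → count c b)) ⟩
    (∑[ w < n ] r w + ∑[ w < n ] i w) + (∑[ w < n ] o w + ∑[ w < n ] l w)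
      ≡⟨ sym (+-assoc (∑[ w < n ] r w + ∑[ w < n ] i w) _ _) ⟩
    ∑[ w < n ] r w + ∑[ w < n ] i w + ∑[ w < n ] o w + ∑[ w < n ] l w
      ≡⟨ sym (trans (∑-distrib-+ (λ w → r w + i w + o w) l)
                    (cong (_+ ∑[ w < n ] l w) (trans (∑-distrib-+ (λ w → r w + i w) o)
                                                     (cong (_+ ∑[ w < n ] o w) (∑-distrib-+ r i))))) ⟩
    ∑[ w < n ] colourCount (T w) b ∎
    where
    open ≡-Reasoning
    first : Fin (n + n * h) → Fin k
    first = coronaCase (root ∘ T) (inner ∘ T)
    second : Fin (n + n * h) → Fin h → Fin k
    second = coronaCase (outer ∘ T) (leaf ∘ T)
    r i o l : Fin n → ℕ
    r w = δ (root (T w)) b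
    i w = count (inner (T w)) b
    o w = count (outer (T w)) b
    l w = ∑[ y < h ] count (leaf (T w) y) b

  corona²-equitable : ProperColouring G (root ∘ T) →
    (∀ i j → ∑[ w < n ] colourCount (T w) i ≤ ∑[ w < n ] colourCount (T w) j + 1) →
    EquitableColoring (corona (corona G H) H) k
  corona²-equitable root-proper counts-balanced = record
    { colour   = corona²Colouring
    ; proper   = corona²Colouring-proper root-proper
    ; balanced = λ i j →
        subst₂ (λ x y → x ≤ y + 1) (sym (classCount i)) (sym (classCount j)) (counts-balanced i j)
    }
    where
    classCount : ∀ b → classSize corona²Colouring b ≡ ∑[ w < n ] colourCount (T w) b
    classCount b = trans (classSize≡count corona²Colouring b) (count-corona²Colouring b)

oddLeaf : ℕ → ℕ → Fin 4
oddLeaf = alternate 3F 0F ◃ alternate (alternate 0F 1F) (alternate 3F 2F)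

oddLeaf-proper : ∀ y → ProperSequence (oddLeaf y)
oddLeaf-proper = ◃-all ProperSequence (alternate-proper λ ())
  (alternate-all ProperSequence (alternate-proper λ ()) (alternate-proper λ ()))

oddLeaf-avoids-inner : ∀ y → Avoids (oddLeaf y) (alternate 1F 2F y)
oddLeaf-avoids-inner zero    = alternate-all (_≢ 1F) (λ ()) (λ ())
oddLeaf-avoids-inner (suc y) =
  alternate-rel Avoids (alternate-all (_≢ 2F) (λ ()) (λ ())) (alternate-all (_≢ 1F) (λ ()) (λ ())) y

oddTemplate : ∀ m → TwoLevelColouring (P m) 4
oddTemplate m = record
  { root         = 0F
  ; inner        = alternate 1F 2F ∘ toℕ
  ; outer        = alternate 2F 1F ∘ toℕ
  ; leaf         = λ y → oddLeaf (toℕ y) ∘ toℕ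
  ; inner-proper = path-proper (alternate-proper λ ())
  ; outer-proper = path-proper (alternate-proper λ ())
  ; leaf-proper  = λ y → path-proper (oddLeaf-proper (toℕ y))
  ; inner≢root   = alternate-all (_≢ 0F) (λ ()) (λ ()) ∘ toℕ
  ; outer≢root   = alternate-all (_≢ 0F) (λ ()) (λ ()) ∘ toℕ
  ; leaf≢inner   = λ y x → oddLeaf-avoids-inner (toℕ y) (toℕ x)
  }

oddTemplate-count : ∀ s b → colourCount (oddTemplate (suc (s + s))) b ≡ suc s * suc s
oddTemplate-count s b = begin
  colourCount (oddTemplate (suc (s + s))) b
    ≡⟨⟩
  d 0F + cnt (alternate 1F 2F) + cnt (alternate 2F 1F)
    + (cnt (alternate 3F 0F) + ∑[ y < s + s ] cnt (alternate M₁ M₂ (toℕ y)))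
    ≡⟨ cong₂ _+_ (cong₂ _+_ (cong (d 0F +_) (cnt-alternate 1F 2F)) (cnt-alternate 2F 1F))
                 (cong₂ _+_ (cnt-alternate 3F 0F) leaves) ⟩
  d 0F + (suc s * d 1F + s * d 2F) + (suc s * d 2F + s * d 1F)
    + ((suc s * d 3F + s * d 0F) + (s * (suc s * d 0F + s * d 1F) + s * (suc s * d 3F + s * d 2F)))
    ≡⟨ collect s (d 0F) (d 1F) (d 2F) (d 3F) ⟩
  suc s * suc s * ∑[ z < 4 ] d z
    ≡⟨ trans (cong (suc s * suc s *_) (∑-δ b)) (*-identityʳ (suc s * suc s)) ⟩
  suc s * suc s ∎
  where
  open ≡-Reasoning
  M₁ M₂ : ℕ → Fin 4
  M₁ = alternate 0F 1F
  M₂ = alternate 3F 2F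
  d : Fin 4 → ℕ
  d z = δ z b
  cnt : (ℕ → Fin 4) → ℕ
  cnt f = ∑[ x < suc (s + s) ] d (f (toℕ x))
  cnt-alternate : ∀ u v → cnt (alternate u v) ≡ suc s * d u + s * d v
  cnt-alternate = ∑-alternate-odd d s
  leaves : ∑[ y < s + s ] cnt (alternate M₁ M₂ (toℕ y))
           ≡ s * (suc s * d 0F + s * d 1F) + s * (suc s * d 3F + s * d 2F)
  leaves = trans (∑-alternate-double cnt s M₁ M₂)
                 (cong₂ (λ x y → s * x + s * y) (cnt-alternate 0F 1F) (cnt-alternate 3F 2F))
  collect : ∀ s d₀ d₁ d₂ d₃ →
    d₀ + (suc s * d₁ + s * d₂) + (suc s * d₂ + s * d₁)
      + ((suc s * d₃ + s * d₀) + (s * (suc s * d₀ + s * d₁) + s * (suc s * d₃ + s * d₂)))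
    ≡ suc s * suc s * (d₀ + (d₁ + (d₂ + (d₃ + 0))))
  collect = solve-∀

-- For even m, (m + 1)² ≡ 1 (mod 4): the even template uses every colour equally often
-- except extraSlot t, which occurs once more. The two variants differ only in the first
-- vertex of the leaf path below inner vertex 1.
extraSlot : Bool → Fin 4
extraSlot false = 0F
extraSlot true  = 3F

extraSlot≢1 : ∀ t → extraSlot t ≢ 1F
extraSlot≢1 false ()
extraSlot≢1 true  ()

extraSlot≢2 : ∀ t → extraSlot t ≢ 2F
extraSlot≢2 false ()
extraSlot≢2 true  ()

evenLeaf : Bool → ℕ → ℕ → Fin 4
evenLeaf t = (3F ◃ alternate 0F 2F) ◃ (extraSlot t ◃ alternate 1F 3F)
           ◃ alternate (3F ◃ alternate 0F 2F) (0F ◃ alternate 3F 1F)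

evenLeaf-proper : ∀ t y → ProperSequence (evenLeaf t y)
evenLeaf-proper t = ◃-all ProperSequence L₀-proper
  (◃-all ProperSequence (◃-proper (extraSlot≢1 t) (alternate-proper λ ()))
    (alternate-all ProperSequence L₀-proper (◃-proper (λ ()) (alternate-proper λ ()))))
  where
  L₀-proper : ProperSequence (3F ◃ alternate 0F 2F)
  L₀-proper = ◃-proper (λ ()) (alternate-proper λ ())

evenLeaf-avoids-inner : ∀ t y → Avoids (evenLeaf t y) (alternate 1F 2F y)
evenLeaf-avoids-inner t 0 = ◃-all (_≢ 1F) (λ ()) (alternate-all (_≢ 1F) (λ ()) (λ ()))
evenLeaf-avoids-inner t 1 = ◃-all (_≢ 2F) (extraSlot≢2 t) (alternate-all (_≢ 2F) (λ ()) (λ ()))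
evenLeaf-avoids-inner t (suc (suc y)) = alternate-rel Avoids (evenLeaf-avoids-inner t 0)
  (◃-all (_≢ 2F) (λ ()) (alternate-all (_≢ 2F) (λ ()) (λ ()))) y

evenTemplate : Bool → ∀ m → TwoLevelColouring (P m) 4
evenTemplate t m = record
  { root         = 0F
  ; inner        = alternate 1F 2F ∘ toℕ
  ; outer        = (3F ◃ alternate 2F 1F) ∘ toℕ
  ; leaf         = λ y → evenLeaf t (toℕ y) ∘ toℕ
  ; inner-proper = path-proper (alternate-proper λ ())
  ; outer-proper = path-proper (◃-proper (λ ()) (alternate-proper λ ()))
  ; leaf-proper  = λ y → path-proper (evenLeaf-proper t (toℕ y))
  ; inner≢root   = alternate-all (_≢ 0F) (λ ()) (λ ()) ∘ toℕ
  ; outer≢root   = ◃-all (_≢ 0F) (λ ()) (alternate-all (_≢ 0F) (λ ()) (λ ())) ∘ toℕ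
  ; leaf≢inner   = λ y x → evenLeaf-avoids-inner t (toℕ y) (toℕ x)
  }

evenTemplate-count : ∀ r t b →
  colourCount (evenTemplate t (suc (suc (r + r)))) b ≡ suc r * suc (suc r) + δ (extraSlot t) b
evenTemplate-count r t b = begin
  colourCount (evenTemplate t (suc (suc (r + r)))) b
    ≡⟨⟩
  d 0F + ∑[ x < suc (suc (r + r)) ] d (alternate 1F 2F (toℕ x)) + cnt (3F ◃ alternate 2F 1F)
    + (cnt L₀ + (cnt (extraSlot t ◃ alternate 1F 3F) + ∑[ y < r + r ] cnt (alternate L₀ L₁ (toℕ y))))
    ≡⟨ cong₂ _+_ (cong₂ _+_ (cong (d 0F +_) (∑-alternate-even d r 1F 2F)) (cnt◃ 3F 2F 1F))
                 (cong₂ _+_ (cnt◃ 3F 0F 2F)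
                            (cong₂ _+_ (cnt◃ (extraSlot t) 1F 3F) leaves)) ⟩
  d 0F + (suc r * d 1F + suc r * d 2F) + (d 3F + (suc r * d 2F + r * d 1F))
    + ((d 3F + (suc r * d 0F + r * d 2F)) + ((d (extraSlot t) + (suc r * d 1F + r * d 3F))
      + (r * (d 3F + (suc r * d 0F + r * d 2F)) + r * (d 0F + (suc r * d 3F + r * d 1F)))))
    ≡⟨ collect r (d 0F) (d 1F) (d 2F) (d 3F) (d (extraSlot t)) ⟩
  q * ∑[ z < 4 ] d z + d (extraSlot t)
    ≡⟨ cong (_+ d (extraSlot t)) (trans (cong (q *_) (∑-δ b)) (*-identityʳ q)) ⟩
  q + d (extraSlot t) ∎
  where
  open ≡-Reasoning
  q = suc r * suc (suc r)
  L₀ L₁ : ℕ → Fin 4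
  L₀ = 3F ◃ alternate 0F 2F
  L₁ = 0F ◃ alternate 3F 1F
  d : Fin 4 → ℕ
  d z = δ z b
  cnt : (ℕ → Fin 4) → ℕ
  cnt f = ∑[ x < suc (suc (r + r)) ] d (f (toℕ x))
  cnt◃ : ∀ z u v → cnt (z ◃ alternate u v) ≡ d z + (suc r * d u + r * d v)
  cnt◃ z u v = cong (d z +_) (∑-alternate-odd d r u v)
  leaves : ∑[ y < r + r ] cnt (alternate L₀ L₁ (toℕ y))
           ≡ r * (d 3F + (suc r * d 0F + r * d 2F)) + r * (d 0F + (suc r * d 3F + r * d 1F))
  leaves = trans (∑-alternate-double cnt r L₀ L₁)
                 (cong₂ (λ x y → r * x + r * y) (cnt◃ 3F 0F 2F) (cnt◃ 0F 3F 1F))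
  collect : ∀ r d₀ d₁ d₂ d₃ e →
    d₀ + (suc r * d₁ + suc r * d₂) + (d₃ + (suc r * d₂ + r * d₁))
      + ((d₃ + (suc r * d₀ + r * d₂)) + ((e + (suc r * d₁ + r * d₃))
        + (r * (d₃ + (suc r * d₀ + r * d₂)) + r * (d₀ + (suc r * d₃ + r * d₁)))))
    ≡ suc r * suc (suc r) * (d₀ + (d₁ + (d₂ + (d₃ + 0)))) + e
  collect = solve-∀

-- No permutation sends both 0F and 3F to the same colour, so when e ≡ a the variant
-- whose surplus sits at the root colour 0F is used.
relabelling : ∀ (a e : Fin 4) →
              ∃ λ t → ∃ λ (π : Permutation′ 4) → π ⟨$⟩ʳ 0F ≡ a × π ⟨$⟩ʳ extraSlot t ≡ e
relabelling a e with a ≟ e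
... | yes refl = false , transpose 0F a , transpose-sends 0F a , transpose-sends 0F a
... | no a≢e   = true , permutation-sending (λ ()) a≢e

oddBlock : ∀ m → Fin 4 → TwoLevelColouring (P m) 4
oddBlock m a = relabel (transpose 0F a) (oddTemplate m)

oddBlock-count : ∀ s a b → colourCount (oddBlock (suc (s + s)) a) b ≡ suc s * suc s
oddBlock-count s a b = trans (colourCount-relabel (transpose 0F a) (oddTemplate (suc (s + s))) b)
                             (oddTemplate-count s (transpose 0F a ⟨$⟩ˡ b))

evenBlock : ∀ m → Fin 4 → Fin 4 → TwoLevelColouring (P m) 4
evenBlock m a e = let t , π , _ = relabelling a e in relabel π (evenTemplate t m)

evenBlock-root : ∀ m a e → root (evenBlock m a e) ≡ a
evenBlock-root m a e with relabelling a e
... | _ , _ , π0≡a , _ = π0≡a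

evenBlock-count : ∀ r a e b →
                  colourCount (evenBlock (suc (suc (r + r))) a e) b ≡ suc r * suc (suc r) + δ e b
evenBlock-count r a e b with relabelling a e
... | t , π , _ , πslot≡e = begin
  colourCount (relabel π (evenTemplate t m)) b        ≡⟨ colourCount-relabel π (evenTemplate t m) b ⟩
  colourCount (evenTemplate t m) (π ⟨$⟩ˡ b)           ≡⟨ evenTemplate-count r t (π ⟨$⟩ˡ b) ⟩
  q + δ (extraSlot t) (π ⟨$⟩ˡ b)                      ≡⟨ cong (q +_) (sym (δ-permute π (extraSlot t) b)) ⟩
  q + δ (π ⟨$⟩ʳ extraSlot t) b                        ≡⟨ cong (λ c → q + δ c b) πslot≡e ⟩
  q + δ e b                                           ∎
  where
  open ≡-Reasoning
  m = suc (suc (r + r))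
  q = suc r * suc (suc r)

cyclic : ℕ → Fin 4
cyclic 0 = 0F
cyclic 1 = 1F
cyclic 2 = 2F
cyclic 3 = 3F
cyclic (suc (suc (suc (suc x)))) = cyclic x

cyclicCount : ℕ → Fin 4 → ℕ
cyclicCount n b = ∑[ i < n ] δ (cyclic (toℕ i)) b

cyclicCount-period : ∀ n b → cyclicCount (4 + n) b ≡ suc (cyclicCount n b)
cyclicCount-period n b = trans (regroup (δ 0F b) (δ 1F b) (δ 2F b) (δ 3F b) (cyclicCount n b))
                               (cong (_+ cyclicCount n b) (∑-δ b))
  where
  regroup : ∀ a₀ a₁ a₂ a₃ x → a₀ + (a₁ + (a₂ + (a₃ + x))) ≡ a₀ + (a₁ + (a₂ + (a₃ + 0))) + x
  regroup = solve-∀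

cyclicCount-short : ∀ n k b → n + k ≡ 4 → cyclicCount n b ≤ 1
cyclicCount-short n k b n+k≡4 = begin
  cyclicCount n b        ≤⟨ ∑-prefix n k (λ x → δ (cyclic x) b) ⟩
  cyclicCount (n + k) b  ≡⟨ cong (λ N → cyclicCount N b) n+k≡4 ⟩
  cyclicCount 4 b        ≡⟨ ∑-δ b ⟩
  1                      ∎
  where open ≤-Reasoning

cyclic-balanced : ∀ n b b′ → cyclicCount n b ≤ cyclicCount n b′ + 1
cyclic-balanced 0 b b′ = z≤n
cyclic-balanced 1 b b′ = ≤-trans (cyclicCount-short 1 3 b refl) (m≤n+m 1 _)
cyclic-balanced 2 b b′ = ≤-trans (cyclicCount-short 2 2 b refl) (m≤n+m 1 _)
cyclic-balanced 3 b b′ = ≤-trans (cyclicCount-short 3 1 b refl) (m≤n+m 1 _)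
cyclic-balanced (suc (suc (suc (suc n)))) b b′ = begin
  cyclicCount (4 + n) b           ≡⟨ cyclicCount-period n b ⟩
  suc (cyclicCount n b)           ≤⟨ s≤s (cyclic-balanced n b b′) ⟩
  suc (cyclicCount n b′ + 1)      ≡⟨ cong (_+ 1) (cyclicCount-period n b′) ⟨
  cyclicCount (4 + n) b′ + 1      ∎
  where open ≤-Reasoning

data Parity : ℕ → Set where
  odd  : ∀ s → Parity (suc (s + s))
  even : ∀ r → Parity (suc (suc (r + r)))

parity : ∀ n → Parity (suc n)
parity zero = odd 0
parity (suc n) with parity n
... | odd s  = even s
... | even r = subst (λ x → Parity (suc (suc x))) (+-suc r r) (odd (suc r))

module _ {G : Graph} (c : Fin (size G) → Fin 4) (c-proper : ProperColouring G c) where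

  private
    n = size G

  corona²-odd-path-equitable4 : ∀ s →
    EquitableColoring (corona (corona G (P (suc (s + s)))) (P (suc (s + s)))) 4
  corona²-odd-path-equitable4 s = corona²-equitable (oddBlock (suc (s + s)) ∘ c)
    (ProperColouring-resp G (λ w → sym (transpose-sends 0F (c w))) c-proper)
    (λ i j → ≤-trans (≤-reflexive (trans (blocks i) (sym (blocks j)))) (m≤m+n _ 1))
    where
    blocks : ∀ b → ∑[ w < n ] colourCount (oddBlock (suc (s + s)) (c w)) b ≡ n * (suc s * suc s)
    blocks b = trans (sum-cong-≗ λ w → oddBlock-count s (c w) b) (∑-const n (suc s * suc s))

  corona²-even-path-equitable4 : ∀ r →
    EquitableColoring (corona (corona G (P (suc (suc (r + r))))) (P (suc (suc (r + r))))) 4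
  corona²-even-path-equitable4 r = corona²-equitable block
    (ProperColouring-resp G (λ w → sym (evenBlock-root m (c w) (cyclic (toℕ w)))) c-proper)
    (λ i j → begin
       ∑[ w < n ] colourCount (block w) i      ≡⟨ blocks i ⟩
       n * q + cyclicCount n i                 ≤⟨ +-monoʳ-≤ (n * q) (cyclic-balanced n i j) ⟩
       n * q + (cyclicCount n j + 1)           ≡⟨ +-assoc (n * q) _ 1 ⟨
       n * q + cyclicCount n j + 1             ≡⟨ cong (_+ 1) (blocks j) ⟨
       ∑[ w < n ] colourCount (block w) j + 1  ∎)
    where
    open ≤-Reasoning
    m = suc (suc (r + r))
    q = suc r * suc (suc r)
    block : Fin n → TwoLevelColouring (P m) 4
    block w = evenBlock m (c w) (cyclic (toℕ w))
    blocks : ∀ b → ∑[ w < n ] colourCount (block w) b ≡ n * q + cyclicCount n b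
    blocks b = begin-equality
      ∑[ w < n ] colourCount (block w) b
        ≡⟨ sum-cong-≗ (λ w → evenBlock-count r (c w) (cyclic (toℕ w)) b) ⟩
      ∑[ w < n ] (q + δ (cyclic (toℕ w)) b)     ≡⟨ ∑-distrib-+ {n} (λ _ → q) (λ w → δ (cyclic (toℕ w)) b) ⟩
      ∑[ w < n ] q + cyclicCount n b            ≡⟨ cong (_+ cyclicCount n b) (∑-const n q) ⟩
      n * q + cyclicCount n b                   ∎

  corona²-path-equitable4 : ∀ m → EquitableColoring (corona (corona G (P (suc m))) (P (suc m))) 4
  corona²-path-equitable4 m with parity m
  ... | odd s  = corona²-odd-path-equitable4 s
  ... | even r = corona²-even-path-equitable4 r

coronaIter-equitable4 : ∀ m l → EquitableColoring (coronaIter K1 (P (suc m)) (suc (suc l))) 4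
coronaIter-equitable4 m l =
  let c , c-proper = coronaIter-proper3 (suc m) l in
  corona²-path-equitable4 (inject₁ ∘ c) (λ u v u~v → c-proper u v u~v ∘ Fin.inject₁-injective) m

corollary4 : ∀ (m l : ℕ) → 2 ≤ m → 2 ≤ l →
    (m ≡ 4 → IsEqChromaticNumber (coronaIter K1 (P m) l) 3) ×
    (m ≢ 4 → ∃ λ k → IsEqChromaticNumber (coronaIter K1 (P m) l) k × k ≤ 4)
corollary4 (suc m) (suc (suc l)) 2≤m _ =
  χ₌≡3 , λ _ → eqChromaticNumber-exists _ (coronaIter-equitable4 m l)
  where
  χ₌≡3 : suc m ≡ 4 → IsEqChromaticNumber (coronaIter K1 (P (suc m)) (suc (suc l))) 3
  χ₌≡3 refl = coronaIter-P4-equitable3 (suc (suc l))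
            , λ j j<3 E → <⇒≱ j<3 (coronaIter-needs-3-colours {l = suc l} 2≤m E)
corollary4 zero    _          ()  _
corollary4 (suc m) zero       _   ()
corollary4 (suc m) (suc zero) _   (s≤s ())
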